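{- Let $\mathbf{X}$ and $\mathbf{Y}$ be topological spaces with carriers $X$ and $Y$, let $\mathcal U=\{U_i\}_{i\in I}$ be an indexed base of $\mathbf X$ and $\mathcal V=\{V_j\}_{j\in J}$ an indexed base of $\mathbf Y$, where $I,J\subseteq\mathbb N$, and let $f:E\to Y$ with $E\subseteq X$. Suppose the set $J$ is recursively enumerable and there exists a recursively enumerable subset $H$ of $I^3$ such that for all $i_1,i_2\in I$, $U_{i_1}\cap U_{i_2}=\bigcup\{U_i\mid (i_1,i_2,i)\in H\}$. Then $f$ is $(\mathcal U,\mathcal V)$-computable if and only if there exists a recursively enumerable $(\mathcal U,\mathcal V)$-approximation system for $f$.
   Context: A $(\mathcal U,\mathcal V)$-approximation system for $f$ is a subset $R\subseteq I\times J$ such that for every $x\in E$ and every $j\in J$: $f(x)\in V_j$ if and only if there exists $i$ with $(i,j)\in R$ and $x\in U_i$. For $x\in X$ let $[x]_{\mathcal U}=\{i\in I\mid x\in U_i\}$ and for $y\in Y$ let $[y]_{\mathcal V}=\{j\in J\mid y\in V_j\}$. The function $f$ is $(\mathcal U,\mathcal V)$-computable if there exists an enumeration operator $F:\mathcal P(\mathbb N)\to\mathcal P(\mathbb N)$ such that $[f(x)]_{\mathcal V}=F([x]_{\mathcal U})$ for every $x\in E$. -}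

module Defs where

open import Data.Nat using (ℕ; zero; suc; _%_; _/_)
open import Data.Fin using (Fin)
open import Data.Vec using (Vec; []; _∷_; lookup)
open import Data.Product using (Σ; ∃; _×_; _,_)
open import Function.Bundles using (_⇔_)
open import Data.Unit using (⊤)
open import Relation.Binary.PropositionalEquality using (_≡_)

data PR : ℕ → Set where
  pzero : ∀ {n} → PR n
  psucc : PR 1
  pproj : ∀ {n} → Fin n → PR n
  pcomp : ∀ {m n} → PR m → Vec (PR n) m → PR n
  prec  : ∀ {n} → PR n → PR (suc (suc n)) → PR (suc n)

mutual
  eval : ∀ {n} → PR n → Vec ℕ n → ℕ
  eval pzero xs = 0
  eval psucc (x ∷ []) = suc x
  eval (pproj i) xs = lookup xs i
  eval (pcomp g hs) xs = eval g (evalVec hs xs)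
  eval (prec g h) (zero ∷ xs) = eval g xs
  eval (prec g h) (suc k ∷ xs) = eval h (k ∷ eval (prec g h) (k ∷ xs) ∷ xs)

  evalVec : ∀ {m n} → Vec (PR n) m → Vec ℕ n → Vec ℕ m
  evalVec [] xs = []
  evalVec (h ∷ hs) xs = eval h xs ∷ evalVec hs xs

-- Recursively enumerable k-ary relations on ℕ (Σ⁰₁ / Kleene normal form):
-- P is r.e. iff there is a primitive recursive p with
--   P xs  ⇔  ∃ k. p(xs, k) = 0.

RERel : (k : ℕ) → (Vec ℕ k → Set) → Set
RERel k P = Σ (PR (suc k)) λ p →
  ∀ (xs : Vec ℕ k) → P xs ⇔ (∃ λ t → eval p (t ∷ xs) ≡ 0)

RE : (ℕ → Set) → Set
RE A = RERel 1 λ { (n ∷ []) → A n }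

RE₂ : (ℕ → ℕ → Set) → Set
RE₂ P = RERel 2 λ { (a ∷ b ∷ []) → P a b }

RE₃ : (ℕ → ℕ → ℕ → Set) → Set
RE₃ P = RERel 3 λ { (a ∷ b ∷ c ∷ []) → P a b c }

-- Canonical finite sets: D u = { m | the m-th binary digit of u is 1 }

bit : ℕ → ℕ → ℕ
bit u zero = u % 2
bit u (suc m) = bit (u / 2) m

D : ℕ → ℕ → Set
D u m = bit u m ≡ 1

_⊆_ : (ℕ → Set) → (ℕ → Set) → Set
A ⊆ B = ∀ n → A n → B n

EnumOp : (ℕ → ℕ → Set) → (ℕ → Set) → (ℕ → Set)
EnumOp W A n = ∃ λ u → W n u × (D u ⊆ A)

IsEnumOp : ((ℕ → Set) → (ℕ → Set)) → Set₁
IsEnumOp F = Σ (ℕ → ℕ → Set) λ W → RE₂ W × (∀ A n → F A n ⇔ EnumOp W A n)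

record Topology (X : Set) : Set₁ where
  field
    Open      : (X → Set) → Set
    open-resp : ∀ {O O′ : X → Set} → (∀ x → O x ⇔ O′ x) → Open O → Open O′
    open-full : Open (λ _ → ⊤)
    open-∩    : ∀ {O O′} → Open O → Open O′ → Open (λ x → O x × O′ x)
    open-⋃    : ∀ {K : Set} (G : K → X → Set) → (∀ k → Open (G k)) →
                Open (λ x → ∃ λ k → G k x)

record IsBase {X : Set} (T : Topology X) (I : ℕ → Set) (U : ℕ → X → Set) : Set₁ where
  open Topology T
  field
    base-open  : ∀ i → I i → Open (U i)
    base-cover : ∀ (O : X → Set) → Open O → ∀ x → O x →
                 ∃ λ i → I i × U i x × (∀ y → U i y → O y)

[_]⟨_,_⟩ : {X : Set} → X → (ℕ → Set) → (ℕ → X → Set) → ℕ → Set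
[ x ]⟨ I , U ⟩ i = I i × U i x

IsApproxSystem : {X Y : Set} (I : ℕ → Set) (U : ℕ → X → Set)
                 (J : ℕ → Set) (V : ℕ → Y → Set)
                 (E : X → Set) (f : (x : X) → E x → Y) →
                 (ℕ → ℕ → Set) → Set
IsApproxSystem I U J V E f R =
  (∀ i j → R i j → I i × J j) ×
  (∀ x (e : E x) j → J j → V j (f x e) ⇔ (∃ λ i → R i j × U i x))

IsComputable : {X Y : Set} (I : ℕ → Set) (U : ℕ → X → Set)
               (J : ℕ → Set) (V : ℕ → Y → Set)
               (E : X → Set) (f : (x : X) → E x → Y) → Set₁
IsComputable I U J V E f =
  Σ ((ℕ → Set) → (ℕ → Set)) λ F → IsEnumOp F ×
    (∀ x (e : E x) j → [ f x e ]⟨ J , V ⟩ j ⇔ F [ x ]⟨ I , U ⟩ j)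

-- (⇐) An r.e. approximation system R gives the enumeration operator A ↦ {j | ∃ i. R i j ∧ i ∈ A},
-- whose graph pairs j with the codes 2 ^ i of the singletons {i}.
-- (⇒) If [f x]_V = Φ_W [x]_U, then f x ∈ V j iff x lies in ⋂_{k ∈ D u} U k for some (j , u) ∈ W.
-- Chaining the intersection relation H along D u enumerates basic sets whose union is that finite
-- intersection, so relating i to j when j ∈ J and i ends such a chain for some (j , u) ∈ W gives an
-- approximation system.  It is r.e. because r.e. relations, given in Kleene normal form, are closed
-- under ∧, ∨, ∃, substitution and bounded ∀ (witnesses are combined by Cantor pairing).

module Submission where

open import Defs
open import Data.Nat using (ℕ; zero; suc; _+_; _*_; _∸_; _^_; pred; _≤_; _<_; z≤n; s≤s)
open import Data.Nat.Properties
open import Data.Nat.DivMod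
open import Data.Fin using (Fin; zero; suc; #_)
open import Data.Vec using (Vec; []; _∷_; lookup; _++_)
open import Data.Product using (Σ; ∃; _×_; _,_; proj₁; proj₂)
open import Data.Sum using (_⊎_; inj₁; inj₂; [_,_]′) renaming (map to ⊎-map)
open import Data.Unit using (tt)
open import Data.Empty using (⊥-elim)
open import Function.Base using (flip)
open import Function.Bundles using (_⇔_; mk⇔; Equivalence)
open import Function.Properties.Equivalence using ()
  renaming (refl to ⇔-refl; sym to ⇔-sym; trans to ⇔-trans)
open import Function.Related.Propositional using (≡⇒)
open import Relation.Binary.Definitions using (tri<; tri≈; tri>)
open import Relation.Binary.PropositionalEquality
open import Relation.Nullary using (yes; no; contradiction)

open Equivalence using (to; from)

PrimRec : (n : ℕ) → (Vec ℕ n → ℕ) → Set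
PrimRec n f = Σ (PR n) λ p → ∀ xs → eval p xs ≡ f xs

primRec-resp : ∀ {n} {f g : Vec ℕ n → ℕ} → (∀ xs → f xs ≡ g xs) → PrimRec n f → PrimRec n g
primRec-resp f≗g (p , p≗f) = p , λ xs → trans (p≗f xs) (f≗g xs)

primRec-eval : ∀ {n} (p : PR n) → PrimRec n (eval p)
primRec-eval p = p , λ _ → refl

primRec-rec : ∀ {n} {g : Vec ℕ n → ℕ} {h : Vec ℕ (suc (suc n)) → ℕ}
  (f : Vec ℕ (suc n) → ℕ) → PrimRec n g → PrimRec (suc (suc n)) h →
  (∀ xs → f (0 ∷ xs) ≡ g xs) → (∀ k xs → f (suc k ∷ xs) ≡ h (k ∷ f (k ∷ xs) ∷ xs)) →
  PrimRec (suc n) f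
primRec-rec {h = h} f (pg , pg≗g) (ph , ph≗h) f-zero f-suc = prec pg ph , rec≗f
  where
  rec≗f : ∀ xs → eval (prec pg ph) xs ≡ f xs
  rec≗f (zero ∷ xs) = trans (pg≗g xs) (sym (f-zero xs))
  rec≗f (suc k ∷ xs) = begin
    eval ph (k ∷ eval (prec pg ph) (k ∷ xs) ∷ xs)  ≡⟨ cong (λ r → eval ph (k ∷ r ∷ xs)) (rec≗f _) ⟩
    eval ph (k ∷ f (k ∷ xs) ∷ xs)                  ≡⟨ ph≗h _ ⟩
    h (k ∷ f (k ∷ xs) ∷ xs)                        ≡⟨ f-suc k xs ⟨
    f (suc k ∷ xs)                                 ∎
    where open ≡-Reasoning

-- Compiled to PR codes, these terms let primitive recursive functions be written as
-- ordinary arithmetic expressions.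
data Expr (n : ℕ) : Set where
  var : Fin n → Expr n
  lit : ℕ → Expr n
  app : ∀ {k} {g : Vec ℕ k → ℕ} → PrimRec k g → Vec (Expr n) k → Expr n

mutual
  ⟦_⟧ : ∀ {n} → Expr n → Vec ℕ n → ℕ
  ⟦ var i ⟧ xs = lookup xs i
  ⟦ lit k ⟧ xs = k
  ⟦ app {g = g} _ es ⟧ xs = g (⟦ es ⟧* xs)

  ⟦_⟧* : ∀ {n k} → Vec (Expr n) k → Vec ℕ n → Vec ℕ k
  ⟦ [] ⟧* xs = []
  ⟦ e ∷ es ⟧* xs = ⟦ e ⟧ xs ∷ ⟦ es ⟧* xs

literal : ∀ {n} → ℕ → PR n
literal zero = pzero
literal (suc k) = pcomp psucc (literal k ∷ [])

eval-literal : ∀ {n} k (xs : Vec ℕ n) → eval (literal k) xs ≡ k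
eval-literal zero xs = refl
eval-literal (suc k) xs = cong suc (eval-literal k xs)

mutual
  compile : ∀ {n} → Expr n → PR n
  compile (var i) = pproj i
  compile (lit k) = literal k
  compile (app (p , _) es) = pcomp p (compile* es)

  compile* : ∀ {n k} → Vec (Expr n) k → Vec (PR n) k
  compile* [] = []
  compile* (e ∷ es) = compile e ∷ compile* es

mutual
  eval-compile : ∀ {n} (e : Expr n) xs → eval (compile e) xs ≡ ⟦ e ⟧ xs
  eval-compile (var i) xs = refl
  eval-compile (lit k) xs = eval-literal k xs
  eval-compile (app (p , p≗g) es) xs = trans (cong (eval p) (evalVec-compile* es xs)) (p≗g _)

  evalVec-compile* : ∀ {n k} (es : Vec (Expr n) k) xs → evalVec (compile* es) xs ≡ ⟦ es ⟧* xs
  evalVec-compile* [] xs = refl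
  evalVec-compile* (e ∷ es) xs = cong₂ _∷_ (eval-compile e xs) (evalVec-compile* es xs)

expr-primRec : ∀ {n} (e : Expr n) → PrimRec n ⟦ e ⟧
expr-primRec e = compile e , eval-compile e

call : ∀ {n k} → PR k → Vec (Expr n) k → Expr n
call p = app (primRec-eval p)

mutual
  weaken : ∀ {n} → Expr n → Expr (suc n)
  weaken (var i) = var (suc i)
  weaken (lit k) = lit k
  weaken (app p es) = app p (weaken* es)

  weaken* : ∀ {n k} → Vec (Expr n) k → Vec (Expr (suc n)) k
  weaken* [] = []
  weaken* (e ∷ es) = weaken e ∷ weaken* es

mutual
  ⟦weaken⟧ : ∀ {n} (e : Expr n) t xs → ⟦ weaken e ⟧ (t ∷ xs) ≡ ⟦ e ⟧ xs
  ⟦weaken⟧ (var i) t xs = refl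
  ⟦weaken⟧ (lit k) t xs = refl
  ⟦weaken⟧ (app {g = g} p es) t xs = cong g (⟦weaken*⟧ es t xs)

  ⟦weaken*⟧ : ∀ {n k} (es : Vec (Expr n) k) t xs → ⟦ weaken* es ⟧* (t ∷ xs) ≡ ⟦ es ⟧* xs
  ⟦weaken*⟧ [] t xs = refl
  ⟦weaken*⟧ (e ∷ es) t xs = cong₂ _∷_ (⟦weaken⟧ e t xs) (⟦weaken*⟧ es t xs)

rest : ∀ k {n} → Vec (Expr (k + n)) n
rest zero {zero} = []
rest zero {suc n} = var zero ∷ weaken* (rest zero)
rest (suc k) = weaken* (rest k)

⟦rest⟧ : ∀ k {n} (ys : Vec ℕ k) (xs : Vec ℕ n) → ⟦ rest k ⟧* (ys ++ xs) ≡ xs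
⟦rest⟧ zero [] [] = refl
⟦rest⟧ zero [] (x ∷ xs) = cong (x ∷_) (trans (⟦weaken*⟧ (rest zero) x xs) (⟦rest⟧ zero [] xs))
⟦rest⟧ (suc k) (y ∷ ys) xs = trans (⟦weaken*⟧ (rest k) y (ys ++ xs)) (⟦rest⟧ k ys xs)

⟦++⟧* : ∀ {n j k} (es : Vec (Expr n) j) (fs : Vec (Expr n) k) xs →
  ⟦ es ++ fs ⟧* xs ≡ ⟦ es ⟧* xs ++ ⟦ fs ⟧* xs
⟦++⟧* [] fs xs = refl
⟦++⟧* (e ∷ es) fs xs = cong (⟦ e ⟧ xs ∷_) (⟦++⟧* es fs xs)

⟦call-rest⟧ : ∀ {n j} k (p : PR (j + n)) (es : Vec (Expr (k + n)) j) (ys : Vec ℕ k) xs →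
  ⟦ call p (es ++ rest k) ⟧ (ys ++ xs) ≡ eval p (⟦ es ⟧* (ys ++ xs) ++ xs)
⟦call-rest⟧ k p es ys xs = cong (eval p)
  (trans (⟦++⟧* es (rest k) (ys ++ xs)) (cong (⟦ es ⟧* (ys ++ xs) ++_) (⟦rest⟧ k ys xs)))

⟦call-rest₁⟧ : ∀ {n} (p : PR (suc n)) (e : Expr (suc n)) t xs →
  ⟦ call p (e ∷ rest 1) ⟧ (t ∷ xs) ≡ eval p (⟦ e ⟧ (t ∷ xs) ∷ xs)
⟦call-rest₁⟧ p e t xs = ⟦call-rest⟧ 1 p (e ∷ []) (t ∷ []) xs

lift₁ : (ℕ → ℕ) → Vec ℕ 1 → ℕ
lift₁ f (a ∷ []) = f a

lift₂ : (ℕ → ℕ → ℕ) → Vec ℕ 2 → ℕ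
lift₂ f (a ∷ b ∷ []) = f a b

app₁ : ∀ {n f} → PrimRec 1 (lift₁ f) → Expr n → Expr n
app₁ F a = app F (a ∷ [])

app₂ : ∀ {n f} → PrimRec 2 (lift₂ f) → Expr n → Expr n → Expr n
app₂ F a b = app F (a ∷ b ∷ [])

suc-primRec : PrimRec 1 (lift₁ suc)
suc-primRec = psucc , λ { (x ∷ []) → refl }

+-primRec : PrimRec 2 (lift₂ _+_)
+-primRec = primRec-rec _ (expr-primRec (var (# 0))) (expr-primRec (app₁ suc-primRec (var (# 1))))
  (λ { (b ∷ []) → refl }) (λ { k (b ∷ []) → refl })

infixl 6 _⊕_ _⊖_
infixl 7 _⊗_

_⊕_ : ∀ {n} → Expr n → Expr n → Expr n
_⊕_ = app₂ +-primRec

*-primRec : PrimRec 2 (lift₂ _*_)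
*-primRec = primRec-rec _ (expr-primRec (lit 0)) (expr-primRec (var (# 2) ⊕ var (# 1)))
  (λ { (b ∷ []) → refl }) (λ { k (b ∷ []) → refl })

_⊗_ : ∀ {n} → Expr n → Expr n → Expr n
_⊗_ = app₂ *-primRec

pred-primRec : PrimRec 1 (lift₁ pred)
pred-primRec = primRec-rec _ (expr-primRec (lit 0)) (expr-primRec (var (# 0)))
  (λ { [] → refl }) (λ { k [] → refl })

∸-primRec : PrimRec 2 (lift₂ _∸_)
∸-primRec = primRec-resp (λ { (a ∷ b ∷ []) → refl })
  (expr-primRec (app₂ flipped (var (# 1)) (var (# 0))))
  where
  flipped : PrimRec 2 (lift₂ (flip _∸_))
  flipped = primRec-rec _ (expr-primRec (var (# 0))) (expr-primRec (app₁ pred-primRec (var (# 1))))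
    (λ { (a ∷ []) → refl }) (λ { k (a ∷ []) → sym (pred[m∸n]≡m∸[1+n] a k) })

_⊖_ : ∀ {n} → Expr n → Expr n → Expr n
_⊖_ = app₂ ∸-primRec

2^-primRec : PrimRec 1 (lift₁ (2 ^_))
2^-primRec = primRec-rec _ (expr-primRec (lit 1)) (expr-primRec (var (# 1) ⊕ var (# 1)))
  (λ { [] → refl }) (λ { k [] → cong (2 ^ k +_) (+-identityʳ (2 ^ k)) })

-- Cantor pairing and sequence codes

triangle : ℕ → ℕ
triangle zero = 0
triangle (suc n) = suc n + triangle n

-- 1 ∸ (x ∸ y) is 1 if x ≤ y and 0 otherwise: the index advances exactly when t reaches the first
-- element triangle (suc n) of the next diagonal.
diagonal : ℕ → ℕ
diagonal zero = 0
diagonal (suc t) = diagonal t + (1 ∸ (triangle (suc (diagonal t)) ∸ suc t))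

unpair₂ : ℕ → ℕ
unpair₂ t = t ∸ triangle (diagonal t)

unpair₁ : ℕ → ℕ
unpair₁ t = diagonal t ∸ unpair₂ t

triangle-mono-≤ : ∀ {m n} → m ≤ n → triangle m ≤ triangle n
triangle-mono-≤ {zero} _ = z≤n
triangle-mono-≤ {suc m} {suc n} (s≤s m≤n) = +-mono-≤ (s≤s m≤n) (triangle-mono-≤ m≤n)

InDiagonal : ℕ → ℕ → Set
InDiagonal n t = triangle n ≤ t × t < triangle (suc n)

inDiagonal-unique : ∀ {m n t} → InDiagonal m t → InDiagonal n t → m ≡ n
inDiagonal-unique {m} {n} (lo₁ , hi₁) (lo₂ , hi₂) with <-cmp m n
... | tri≈ _ m≡n _ = m≡n
... | tri< m<n _ _ = contradiction (≤-trans (triangle-mono-≤ m<n) lo₂) (<⇒≱ hi₁)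
... | tri> _ _ n<m = contradiction (≤-trans (triangle-mono-≤ n<m) lo₁) (<⇒≱ hi₂)

inDiagonal-diagonal : ∀ t → InDiagonal (diagonal t) t
inDiagonal-diagonal zero = z≤n , s≤s z≤n
inDiagonal-diagonal (suc t) with inDiagonal-diagonal t | triangle (suc (diagonal t)) ≤? suc t
... | lo , hi | yes next≤ = subst (λ n → InDiagonal n (suc t)) (sym diagonal-suc) (next≤ , next>)
  where
  diagonal-suc : diagonal (suc t) ≡ suc (diagonal t)
  diagonal-suc =
    trans (cong (λ z → diagonal t + (1 ∸ z)) (m≤n⇒m∸n≡0 next≤)) (+-comm (diagonal t) 1)
  next> : suc t < triangle (suc (suc (diagonal t)))
  next> = ≤-trans (s≤s hi) (s≤s (m≤n+m (triangle (suc (diagonal t))) (suc (diagonal t))))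
... | lo , hi | no next≰ =
  subst (λ n → InDiagonal n (suc t)) (sym diagonal-suc) (m≤n⇒m≤1+n lo , ≰⇒> next≰)
  where
  diagonal-suc : diagonal (suc t) ≡ diagonal t
  diagonal-suc =
    trans (cong (diagonal t +_) (m≤n⇒m∸n≡0 (m<n⇒0<n∸m (≰⇒> next≰)))) (+-identityʳ _)

unpair-surjective : ∀ a b → ∃ λ t → unpair₁ t ≡ a × unpair₂ t ≡ b
unpair-surjective a b = t , unpair₁-t , unpair₂-t
  where
  t : ℕ
  t = triangle (a + b) + b
  diagonal-t : diagonal t ≡ a + b
  diagonal-t = inDiagonal-unique (inDiagonal-diagonal t)
    (m≤m+n _ _ , subst (_< triangle (suc (a + b))) (+-comm b (triangle (a + b)))
                   (+-monoˡ-< (triangle (a + b)) (s≤s (m≤n+m b a))))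
  unpair₂-t : unpair₂ t ≡ b
  unpair₂-t = trans (cong (λ n → t ∸ triangle n) diagonal-t) (m+n∸m≡n (triangle (a + b)) b)
  unpair₁-t : unpair₁ t ≡ a
  unpair₁-t = trans (cong₂ _∸_ diagonal-t unpair₂-t) (m+n∸n≡m a b)

-- A number w codes the sequence unpair₁ w, unpair₁ (unpair₂ w), unpair₁ (unpair₂ (unpair₂ w)), …
seqDrop : ℕ → ℕ → ℕ
seqDrop zero w = w
seqDrop (suc m) w = unpair₂ (seqDrop m w)

seqAt : ℕ → ℕ → ℕ
seqAt w m = unpair₁ (seqDrop m w)

seqAt-suc : ∀ w m → seqAt w (suc m) ≡ seqAt (unpair₂ w) m
seqAt-suc w m = cong unpair₁ (seqDrop-suc m w)
  where
  seqDrop-suc : ∀ m w → seqDrop (suc m) w ≡ seqDrop m (unpair₂ w)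
  seqDrop-suc zero w = refl
  seqDrop-suc (suc m) w = cong unpair₂ (seqDrop-suc m w)

seqAt-cons : ∀ a w → ∃ λ w′ → seqAt w′ 0 ≡ a × ∀ m → seqAt w′ (suc m) ≡ seqAt w m
seqAt-cons a w with unpair-surjective a w
... | w′ , w′₁≡a , w′₂≡w =
  w′ , w′₁≡a , λ m → trans (seqAt-suc w′ m) (cong (λ v → seqAt v m) w′₂≡w)

seqAt-set : ∀ L w b → ∃ λ w′ → (∀ m → m < L → seqAt w′ m ≡ seqAt w m) × seqAt w′ L ≡ b
seqAt-set zero w b with seqAt-cons b w
... | w′ , w′₀≡b , _ = w′ , (λ _ ()) , w′₀≡b
seqAt-set (suc L) w b with seqAt-set L (unpair₂ w) b
... | w″ , w″-agrees , w″L≡b with seqAt-cons (seqAt w 0) w″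
... | w′ , w′₀≡w₀ , w′-suc = w′ , w′-agrees , trans (w′-suc L) w″L≡b
  where
  w′-agrees : ∀ m → m < suc L → seqAt w′ m ≡ seqAt w m
  w′-agrees zero _ = w′₀≡w₀
  w′-agrees (suc m) (s≤s m<L) = trans (w′-suc m) (trans (w″-agrees m m<L) (sym (seqAt-suc w m)))

finite-choice : ∀ {Q : ℕ → ℕ → Set} L → (∀ m → m < L → ∃ (Q m)) →
  ∃ λ w → ∀ m → m < L → Q m (seqAt w m)
finite-choice zero _ = 0 , λ _ ()
finite-choice {Q} (suc L) choices with finite-choice L (λ m m<L → choices m (m<n⇒m<1+n m<L))
... | w , w-chooses with choices L ≤-refl
... | s , q with seqAt-set L w s
... | w′ , w′-agrees , w′L≡s = w′ , w′-chooses
  where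
  w′-chooses : ∀ m → m < suc L → Q m (seqAt w′ m)
  w′-chooses m m<1+L with m<1+n⇒m<n∨m≡n m<1+L
  ... | inj₁ m<L = subst (Q m) (sym (w′-agrees m m<L)) (w-chooses m m<L)
  ... | inj₂ refl = subst (Q m) (sym w′L≡s) q

triangle-primRec : PrimRec 1 (lift₁ triangle)
triangle-primRec = primRec-rec _ (expr-primRec (lit 0))
  (expr-primRec (app₁ suc-primRec (var (# 0)) ⊕ var (# 1)))
  (λ { [] → refl }) (λ { k [] → refl })

diagonal-primRec : PrimRec 1 (lift₁ diagonal)
diagonal-primRec = primRec-rec _ (expr-primRec (lit 0))
  (expr-primRec (var (# 1) ⊕ (lit 1 ⊖ (app₁ triangle-primRec (app₁ suc-primRec (var (# 1)))
                                        ⊖ app₁ suc-primRec (var (# 0))))))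
  (λ { [] → refl }) (λ { k [] → refl })

unpair₂-primRec : PrimRec 1 (lift₁ unpair₂)
unpair₂-primRec = primRec-resp (λ { (t ∷ []) → refl })
  (expr-primRec (var (# 0) ⊖ app₁ triangle-primRec (app₁ diagonal-primRec (var (# 0)))))

unpair₁-primRec : PrimRec 1 (lift₁ unpair₁)
unpair₁-primRec = primRec-resp (λ { (t ∷ []) → refl })
  (expr-primRec (app₁ diagonal-primRec (var (# 0)) ⊖ app₁ unpair₂-primRec (var (# 0))))

seqAt-primRec : PrimRec 2 (lift₂ seqAt)
seqAt-primRec = primRec-resp (λ { (w ∷ m ∷ []) → refl })
  (expr-primRec (app₁ unpair₁-primRec (app₂ seqDrop-primRec (var (# 1)) (var (# 0)))))
  where
  seqDrop-primRec : PrimRec 2 (lift₂ seqDrop)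
  seqDrop-primRec = primRec-rec _
    (expr-primRec (var (# 0))) (expr-primRec (app₁ unpair₂-primRec (var (# 1))))
    (λ { (w ∷ []) → refl }) (λ { k (w ∷ []) → refl })

-- Closure properties of r.e. relations

re-resp : ∀ {n} {P Q : Vec ℕ n → Set} → (∀ xs → P xs ⇔ Q xs) → RERel n P → RERel n Q
re-resp P⇔Q (p , P⇔p) = p , λ xs → ⇔-trans (⇔-sym (P⇔Q xs)) (P⇔p xs)

re-expr : ∀ {n} {P : Vec ℕ n → Set} (e : Expr (suc n)) →
  (∀ xs → P xs ⇔ ∃ λ t → ⟦ e ⟧ (t ∷ xs) ≡ 0) → RERel n P
re-expr e P⇔e = compile e , λ xs → ⇔-trans (P⇔e xs) (mk⇔
  (λ (t , e≡0) → t , trans (eval-compile e _) e≡0)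
  (λ (t , e≡0) → t , trans (sym (eval-compile e _)) e≡0))

re-≡0 : ∀ {n} (e : Expr n) → RERel n (λ xs → ⟦ e ⟧ xs ≡ 0)
re-≡0 e = re-expr (weaken e) λ xs → mk⇔
  (λ e≡0 → 0 , trans (⟦weaken⟧ e 0 xs) e≡0)
  (λ (t , e≡0) → trans (sym (⟦weaken⟧ e t xs)) e≡0)

≡⇔∸+∸≡0 : ∀ a b → a ≡ b ⇔ (a ∸ b) + (b ∸ a) ≡ 0
≡⇔∸+∸≡0 a b = mk⇔
  (λ { refl → cong₂ _+_ (n∸n≡0 a) (n∸n≡0 a) })
  (λ sum≡0 → ≤-antisym (m∸n≡0⇒m≤n (m+n≡0⇒m≡0 _ sum≡0))
                       (m∸n≡0⇒m≤n (m+n≡0⇒n≡0 (a ∸ b) sum≡0)))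

re-≡ : ∀ {n} (e₁ e₂ : Expr n) → RERel n (λ xs → ⟦ e₁ ⟧ xs ≡ ⟦ e₂ ⟧ xs)
re-≡ e₁ e₂ = re-resp (λ xs → ⇔-sym (≡⇔∸+∸≡0 (⟦ e₁ ⟧ xs) (⟦ e₂ ⟧ xs)))
                     (re-≡0 (e₁ ⊖ e₂ ⊕ (e₂ ⊖ e₁)))

witness₁ witness₂ : ∀ {n} → Expr (suc n)
witness₁ = app₁ unpair₁-primRec (var zero)
witness₂ = app₁ unpair₂-primRec (var zero)

re-∧ : ∀ {n} {P Q : Vec ℕ n → Set} → RERel n P → RERel n Q → RERel n (λ xs → P xs × Q xs)
re-∧ (p , P⇔p) (q , Q⇔q) =
  re-expr (call p (witness₁ ∷ rest 1) ⊕ call q (witness₂ ∷ rest 1)) λ xs → mk⇔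
    (λ (Pxs , Qxs) →
      let s₁ , p≡0 = to (P⇔p xs) Pxs
          s₂ , q≡0 = to (Q⇔q xs) Qxs
          t , t₁≡s₁ , t₂≡s₂ = unpair-surjective s₁ s₂
      in t , cong₂ _+_
        (trans (⟦call-rest₁⟧ p witness₁ t xs) (trans (cong (λ s → eval p (s ∷ xs)) t₁≡s₁) p≡0))
        (trans (⟦call-rest₁⟧ q witness₂ t xs) (trans (cong (λ s → eval q (s ∷ xs)) t₂≡s₂) q≡0)))
    (λ (t , sum≡0) →
      from (P⇔p xs) (unpair₁ t , trans (sym (⟦call-rest₁⟧ p witness₁ t xs)) (m+n≡0⇒m≡0 _ sum≡0)) ,
      from (Q⇔q xs) (unpair₂ t , trans (sym (⟦call-rest₁⟧ q witness₂ t xs)) (m+n≡0⇒n≡0 _ sum≡0)))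

re-⊎ : ∀ {n} {P Q : Vec ℕ n → Set} → RERel n P → RERel n Q → RERel n (λ xs → P xs ⊎ Q xs)
re-⊎ (p , P⇔p) (q , Q⇔q) =
  re-expr (call p (var zero ∷ rest 1) ⊗ call q (var zero ∷ rest 1)) λ xs → mk⇔
    (λ { (inj₁ Pxs) →
           let t , p≡0 = to (P⇔p xs) Pxs
           in t , cong (_* _) (trans (⟦call-rest₁⟧ p (var zero) t xs) p≡0)
       ; (inj₂ Qxs) →
           let t , q≡0 = to (Q⇔q xs) Qxs
               pₜ = ⟦ call p (var zero ∷ rest 1) ⟧ (t ∷ xs)
           in t , trans (cong (pₜ *_) (trans (⟦call-rest₁⟧ q (var zero) t xs) q≡0)) (*-zeroʳ pₜ) })
    (λ (t , prod≡0) → ⊎-map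
      (λ p≡0 → from (P⇔p xs) (t , trans (sym (⟦call-rest₁⟧ p (var zero) t xs)) p≡0))
      (λ q≡0 → from (Q⇔q xs) (t , trans (sym (⟦call-rest₁⟧ q (var zero) t xs)) q≡0))
      (m*n≡0⇒m≡0∨n≡0 _ prod≡0))

re-∃ : ∀ {n} {P : Vec ℕ (suc n) → Set} → RERel (suc n) P →
  RERel n (λ xs → ∃ λ a → P (a ∷ xs))
re-∃ (p , P⇔p) = re-expr (call p (witness₂ ∷ witness₁ ∷ rest 1)) λ xs → mk⇔
  (λ (a , Paxs) →
    let s , p≡0 = to (P⇔p (a ∷ xs)) Paxs
        t , t₁≡a , t₂≡s = unpair-surjective a s
    in t , trans (⟦call⟧ t xs) (trans (cong₂ (λ s a → eval p (s ∷ a ∷ xs)) t₂≡s t₁≡a) p≡0))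
  (λ (t , p≡0) →
    unpair₁ t , from (P⇔p (unpair₁ t ∷ xs)) (unpair₂ t , trans (sym (⟦call⟧ t xs)) p≡0))
  where
  ⟦call⟧ : ∀ t xs → ⟦ call p (witness₂ ∷ witness₁ ∷ rest 1) ⟧ (t ∷ xs)
                    ≡ eval p (unpair₂ t ∷ unpair₁ t ∷ xs)
  ⟦call⟧ t xs = ⟦call-rest⟧ 1 p (witness₂ ∷ witness₁ ∷ []) (t ∷ []) xs

re-subst : ∀ {m n} {P : Vec ℕ n → Set} → RERel n P → (es : Vec (Expr m) n) →
  RERel m (λ ys → P (⟦ es ⟧* ys))
re-subst (p , P⇔p) es = re-expr (call p (var zero ∷ weaken* es)) λ ys → mk⇔
  (λ Pes → let t , p≡0 = to (P⇔p _) Pes in t , trans (⟦call⟧ t ys) p≡0)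
  (λ (t , p≡0) → from (P⇔p _) (t , trans (sym (⟦call⟧ t ys)) p≡0))
  where
  ⟦call⟧ : ∀ t ys → ⟦ call p (var zero ∷ weaken* es) ⟧ (t ∷ ys) ≡ eval p (t ∷ ⟦ es ⟧* ys)
  ⟦call⟧ t ys = cong (λ vs → eval p (t ∷ vs)) (⟦weaken*⟧ es t ys)

sumBelow : (ℕ → ℕ) → ℕ → ℕ
sumBelow g zero = 0
sumBelow g (suc L) = sumBelow g L + g L

sumBelow≡0⇔ : ∀ g L → sumBelow g L ≡ 0 ⇔ (∀ m → m < L → g m ≡ 0)
sumBelow≡0⇔ g L = mk⇔ (sum≡0⇒ L) (⇒sum≡0 L)
  where
  sum≡0⇒ : ∀ L → sumBelow g L ≡ 0 → ∀ m → m < L → g m ≡ 0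
  sum≡0⇒ (suc L) sum≡0 m m<1+L with m<1+n⇒m<n∨m≡n m<1+L
  ... | inj₁ m<L = sum≡0⇒ L (m+n≡0⇒m≡0 _ sum≡0) m m<L
  ... | inj₂ refl = m+n≡0⇒n≡0 (sumBelow g L) sum≡0
  ⇒sum≡0 : ∀ L → (∀ m → m < L → g m ≡ 0) → sumBelow g L ≡ 0
  ⇒sum≡0 zero _ = refl
  ⇒sum≡0 (suc L) g≡0 =
    cong₂ _+_ (⇒sum≡0 L (λ m m<L → g≡0 m (m<n⇒m<1+n m<L))) (g≡0 L ≤-refl)

boundedSum : ∀ {n} → (Vec ℕ (suc n) → ℕ) → Vec ℕ (suc n) → ℕ
boundedSum g (L ∷ xs) = sumBelow (λ m → g (m ∷ xs)) L

boundedSum-primRec : ∀ {n} {g : Vec ℕ (suc n) → ℕ} →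
  PrimRec (suc n) g → PrimRec (suc n) (boundedSum g)
boundedSum-primRec {g = g} (p , p≗g) =
  primRec-rec _ (expr-primRec (lit 0)) (expr-primRec (var (# 1) ⊕ call p (var zero ∷ rest 2)))
    (λ xs → refl)
    (λ k xs → cong (boundedSum g (k ∷ xs) +_)
      (sym (trans (⟦call-rest⟧ 2 p (var zero ∷ []) (k ∷ _ ∷ []) xs) (p≗g (k ∷ xs)))))

All< : ∀ {n} → (Vec ℕ (suc n) → Set) → Vec ℕ (suc n) → Set
All< P (L ∷ xs) = ∀ m → m < L → P (m ∷ xs)

-- The witnesses for all m < L are packed into one sequence code w.
re-All< : ∀ {n} {P : Vec ℕ (suc n) → Set} → RERel (suc n) P → RERel (suc n) (All< P)
re-All< {n} (p , P⇔p) = re-expr sumE λ { (L ∷ xs) → mk⇔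
    (λ all →
      let w , w-witnesses = finite-choice L (λ m m<L → to (P⇔p (m ∷ xs)) (all m m<L))
      in w , trans (⟦sumE⟧ w L xs)
                   (from (sumBelow≡0⇔ _ L) (λ m m<L → trans (⟦pAtE⟧ m w xs) (w-witnesses m m<L))))
    (λ (w , sum≡0) m m<L →
      let pAt≡0 = to (sumBelow≡0⇔ _ L) (trans (sym (⟦sumE⟧ w L xs)) sum≡0) m m<L
      in from (P⇔p (m ∷ xs)) (seqAt w m , trans (sym (⟦pAtE⟧ m w xs)) pAt≡0)) }
  where
  pAtE : Expr (suc (suc n))
  pAtE = call p (app₂ seqAt-primRec (var (# 1)) (var zero) ∷ var zero ∷ rest 2)
  ⟦pAtE⟧ : ∀ m w xs → ⟦ pAtE ⟧ (m ∷ w ∷ xs) ≡ eval p (seqAt w m ∷ m ∷ xs)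
  ⟦pAtE⟧ m w xs =
    ⟦call-rest⟧ 2 p (app₂ seqAt-primRec (var (# 1)) (var zero) ∷ var zero ∷ []) (m ∷ w ∷ []) xs
  sumE : Expr (suc (suc n))
  sumE = app (boundedSum-primRec (expr-primRec pAtE)) (var (# 1) ∷ var zero ∷ rest 2)
  ⟦sumE⟧ : ∀ w L xs → ⟦ sumE ⟧ (w ∷ L ∷ xs) ≡ sumBelow (λ m → ⟦ pAtE ⟧ (m ∷ w ∷ xs)) L
  ⟦sumE⟧ w L xs = cong (λ vs → boundedSum ⟦ pAtE ⟧ (L ∷ w ∷ vs)) (⟦rest⟧ 2 (w ∷ L ∷ []) xs)

-- Paths along a step relation

Path : (ℕ → ℕ → ℕ → Set) → ℕ → ℕ → ℕ → Set
Path S zero a b = a ≡ b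
Path S (suc L) a b = ∃ λ c → Path S L a c × S L c b

Walk : (ℕ → ℕ → ℕ → Set) → ℕ → (ℕ → ℕ) → Set
Walk S L c = ∀ m → m < L → S m (c m) (c (suc m))

walk⇒Path : ∀ S L c → Walk S L c → Path S L (c 0) (c L)
walk⇒Path S zero c _ = refl
walk⇒Path S (suc L) c walk =
  c L , walk⇒Path S L c (λ m m<L → walk m (m<n⇒m<1+n m<L)) , walk L ≤-refl

Path⇒walk : ∀ S L a b → Path S L a b →
  ∃ λ w → seqAt w 0 ≡ a × seqAt w L ≡ b × Walk S L (seqAt w)
Path⇒walk S zero a b a≡b with seqAt-cons a 0
... | w , w₀≡a , _ = w , w₀≡a , trans w₀≡a a≡b , λ _ ()
Path⇒walk S (suc L) a b (c , path , step) with Path⇒walk S L a c path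
... | w , w₀≡a , wL≡c , walk with seqAt-set (suc L) w b
... | w′ , w′-agrees , w′₁₊L≡b =
  w′ , trans (w′-agrees 0 (s≤s z≤n)) w₀≡a , w′₁₊L≡b , walk′
  where
  walk′ : Walk S (suc L) (seqAt w′)
  walk′ m m<1+L with m<1+n⇒m<n∨m≡n m<1+L
  ... | inj₁ m<L = subst₂ (S m) (sym (w′-agrees m (m<n⇒m<1+n m<L)))
                                (sym (w′-agrees (suc m) (s≤s m<L))) (walk m m<L)
  ... | inj₂ refl = subst₂ (S m) (sym (trans (w′-agrees m ≤-refl) wL≡c)) (sym w′₁₊L≡b) step

Uncurry₃ : ∀ {n} → (ℕ → ℕ → ℕ → Vec ℕ n → Set) → Vec ℕ (3 + n) → Set
Uncurry₃ P (a ∷ b ∷ c ∷ xs) = P a b c xs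

-- A path is coded by the sequence of its vertices.
re-Path : ∀ {n} {S : ℕ → ℕ → ℕ → Vec ℕ n → Set} → RERel (3 + n) (Uncurry₃ S) →
  RERel (3 + n) (Uncurry₃ λ L a b xs → Path (λ m a b → S m a b xs) L a b)
re-Path {n} {S} reS = re-resp Path⇔coded (re-∃ reCodedPath)
  where
  seqAtE : ∀ {k} → Expr k → Expr k → Expr k
  seqAtE = app₂ seqAt-primRec
  Steps : Vec ℕ n → ℕ → ℕ → ℕ → Set
  Steps xs m a b = S m a b xs
  StepAt : Vec ℕ (2 + n) → Set
  StepAt (m ∷ w ∷ xs) = Steps xs m (seqAt w m) (seqAt w (suc m))
  reStepAt : RERel (2 + n) StepAt
  reStepAt = re-resp (λ { (m ∷ w ∷ xs) → ≡⇒ (cong (S m _ _) (⟦rest⟧ 2 (m ∷ w ∷ []) xs)) })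
    (re-subst reS (var zero ∷ seqAtE (var (# 1)) (var zero)
                            ∷ seqAtE (var (# 1)) (app₁ suc-primRec (var zero)) ∷ rest 2))
  CodedPath : Vec ℕ (4 + n) → Set
  CodedPath (w ∷ L ∷ a ∷ b ∷ xs) = seqAt w 0 ≡ a × seqAt w L ≡ b × Walk (Steps xs) L (seqAt w)
  reCodedPath : RERel (4 + n) CodedPath
  reCodedPath = re-resp
    (λ { (w ∷ L ∷ a ∷ b ∷ xs) →
           ≡⇒ (cong (λ vs → seqAt w 0 ≡ a × seqAt w L ≡ b × All< StepAt (L ∷ w ∷ vs))
                    (⟦rest⟧ 4 (w ∷ L ∷ a ∷ b ∷ []) xs)) })
    (re-∧ (re-≡ (seqAtE (var zero) (lit 0)) (var (# 2)))
    (re-∧ (re-≡ (seqAtE (var zero) (var (# 1))) (var (# 3)))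
          (re-subst (re-All< reStepAt) (var (# 1) ∷ var zero ∷ rest 4))))
  Path⇔coded : ∀ ys →
    (∃ λ w → CodedPath (w ∷ ys)) ⇔ Uncurry₃ (λ L a b xs → Path (Steps xs) L a b) ys
  Path⇔coded (L ∷ a ∷ b ∷ xs) = mk⇔
    (λ (w , w₀≡a , wL≡b , walk) →
      subst₂ (Path (Steps xs) L) w₀≡a wL≡b (walk⇒Path (Steps xs) L (seqAt w) walk))
    (Path⇒walk (Steps xs) L a b)

half-suc : ∀ n → suc n / 2 ≡ n ∸ n / 2
half-suc zero = refl
half-suc (suc n) = begin
  suc (suc n) / 2        ≡⟨ m/n≡1+[m∸n]/n {suc (suc n)} {2} (s≤s (s≤s z≤n)) ⟩
  suc (n / 2)            ≡⟨ cong suc (m∸[m∸n]≡n (m/n≤m n 2)) ⟨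
  suc (n ∸ (n ∸ n / 2))  ≡⟨ +-∸-assoc 1 (m∸n≤m n (n / 2)) ⟨
  suc n ∸ (n ∸ n / 2)    ≡⟨ cong (suc n ∸_) (half-suc n) ⟨
  suc n ∸ suc n / 2      ∎
  where open ≡-Reasoning

half-primRec : PrimRec 1 (lift₁ (_/ 2))
half-primRec = primRec-rec _ (expr-primRec (lit 0)) (expr-primRec (var zero ⊖ var (# 1)))
  (λ { [] → refl }) (λ { k [] → half-suc k })

-- halve m u = ⌊u / 2^m⌋, halving last so that it is a primitive recursion on m.
halve : ℕ → ℕ → ℕ
halve zero u = u
halve (suc m) u = halve m u / 2

bit≡halve%2 : ∀ u m → bit u m ≡ halve m u % 2
bit≡halve%2 u zero = refl
bit≡halve%2 u (suc m) = trans (bit≡halve%2 (u / 2) m) (cong (_% 2) (halve-/2 m))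
  where
  halve-/2 : ∀ m → halve m (u / 2) ≡ halve m u / 2
  halve-/2 zero = refl
  halve-/2 (suc m) = cong (_/ 2) (halve-/2 m)

bit-primRec : PrimRec 2 (lift₂ bit)
bit-primRec = primRec-resp
  (λ { (u ∷ m ∷ []) → trans (sym (m%n≡m∸m/n*n (halve m u) 2)) (sym (bit≡halve%2 u m)) })
  (expr-primRec (halveE ⊖ app₁ half-primRec halveE ⊗ lit 2))
  where
  halve-primRec : PrimRec 2 (lift₂ halve)
  halve-primRec = primRec-rec _
    (expr-primRec (var zero)) (expr-primRec (app₁ half-primRec (var (# 1))))
    (λ { (u ∷ []) → refl }) (λ { k (u ∷ []) → refl })
  halveE : Expr 2
  halveE = app₂ halve-primRec (var (# 1)) (var zero)

bit<2 : ∀ u m → bit u m < 2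
bit<2 u zero = m%n<n u 2
bit<2 u (suc m) = bit<2 (u / 2) m

bit≡0⊎D : ∀ u m → bit u m ≡ 0 ⊎ D u m
bit≡0⊎D u m with bit u m | bit<2 u m
... | zero | _ = inj₁ refl
... | suc zero | _ = inj₂ refl
... | suc (suc _) | s≤s (s≤s ())

bit-high : ∀ u m → u < 2 ^ m → bit u m ≡ 0
bit-high zero zero _ = refl
bit-high (suc u) zero (s≤s ())
bit-high u (suc m) u<2^1+m =
  bit-high (u / 2) m (m<n*o⇒m/o<n (subst (u <_) (*-comm 2 (2 ^ m)) u<2^1+m))

n<2^n : ∀ n → n < 2 ^ n
n<2^n zero = s≤s z≤n
n<2^n (suc n) = +-mono-≤ (m^n>0 2 n) (subst (n <_) (sym (+-identityʳ (2 ^ n))) (n<2^n n))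

D⇒< : ∀ {u k} → D u k → k < u
D⇒< {u} {k} Duk with k <? u
... | yes k<u = k<u
... | no k≮u = ⊥-elim (0≢1+n (trans (sym (bit-high u k 2^k>u)) Duk))
  where
  2^k>u : u < 2 ^ k
  2^k>u = <-≤-trans (n<2^n u) (^-monoʳ-≤ 2 (≮⇒≥ k≮u))

[2*n]/2≡n : ∀ n → 2 * n / 2 ≡ n
[2*n]/2≡n n = trans (/-congˡ (*-comm 2 n)) (m*n/n≡m n 2)

[2*n]%2≡0 : ∀ n → 2 * n % 2 ≡ 0
[2*n]%2≡0 n = trans (cong (_% 2) (*-comm 2 n)) (m*n%n≡0 n 2)

D-2^-self : ∀ i → D (2 ^ i) i
D-2^-self zero = refl
D-2^-self (suc i) = trans (cong (λ u → bit u i) ([2*n]/2≡n (2 ^ i))) (D-2^-self i)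

D-2^-unique : ∀ i k → D (2 ^ i) k → k ≡ i
D-2^-unique zero zero _ = refl
D-2^-unique zero (suc k) bit≡1 =
  ⊥-elim (0≢1+n (trans (sym (bit-high 0 k (m^n>0 2 k))) bit≡1))
D-2^-unique (suc i) zero bit≡1 =
  ⊥-elim (0≢1+n (trans (sym ([2*n]%2≡0 (2 ^ i))) bit≡1))
D-2^-unique (suc i) (suc k) bit≡1 =
  cong suc (D-2^-unique i k (trans (cong (λ u → bit u k) (sym ([2*n]/2≡n (2 ^ i)))) bit≡1))

-- Approximation systems and enumeration operators

relationOp : (ℕ → ℕ → Set) → (ℕ → Set) → (ℕ → Set)
relationOp R A j = ∃ λ i → R i j × A i

relationOp-isEnumOp : ∀ {R} → RE₂ R → IsEnumOp (relationOp R)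
relationOp-isEnumOp {R} reR = W , reW , λ A j → mk⇔
  (λ (i , Rij , i∈A) →
    2 ^ i , (i , Rij , refl) , λ k D2^ik → subst A (sym (D-2^-unique i k D2^ik)) i∈A)
  (λ { (_ , (i , Rij , refl) , D⊆A) → i , Rij , D⊆A i (D-2^-self i) })
  where
  W : ℕ → ℕ → Set
  W j u = ∃ λ i → R i j × u ≡ 2 ^ i
  reW : RE₂ W
  reW = re-resp (λ { (j ∷ u ∷ []) → ⇔-refl })
    (re-∃ (re-∧ (re-subst reR (var zero ∷ var (# 1) ∷ []))
                (re-≡ (var (# 2)) (app₁ 2^-primRec (var zero)))))

approxSystem⇒computable : ∀ {X Y : Set} {I U J V E f R} → RE₂ R →
  IsApproxSystem {X} {Y} I U J V E f R → IsComputable I U J V E f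
approxSystem⇒computable {R = R} reR (R⊆I×J , approximates) =
  relationOp R , relationOp-isEnumOp reR , λ x e j → mk⇔
    (λ (Jj , fx∈Vj) →
      let i , Rij , x∈Ui = to (approximates x e j Jj) fx∈Vj
      in i , Rij , proj₁ (R⊆I×J i j Rij) , x∈Ui)
    (λ (i , Rij , _ , x∈Ui) →
      let Jj = proj₂ (R⊆I×J i j Rij)
      in Jj , from (approximates x e j Jj) (i , Rij , x∈Ui))

IsBase-covers : ∀ {X} {T : Topology X} {I U} → IsBase T I U → ∀ x → ∃ λ i → I i × U i x
IsBase-covers {T = T} base x =
  let i , Ii , x∈Ui , _ = IsBase.base-cover base _ (Topology.open-full T) x tt in i , Ii , x∈Ui

module BasicIntersections {X : Set} {I : ℕ → Set} {U : ℕ → X → Set} {H : ℕ → ℕ → ℕ → Set}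
  (H⊆I³ : ∀ a b c → H a b c → I a × I b × I c)
  (H-∩ : ∀ a b → I a → I b → ∀ x → (U a x × U b x) ⇔ (∃ λ c → H a b c × U c x)) where

  Step : ℕ → ℕ → ℕ → ℕ → Set
  Step u m a b = (bit u m ≡ 0 × a ≡ b) ⊎ (D u m × H a m b)

  -- i indexes a basic set inside ⋂_{k ∈ D u} U k, reached from some U a by intersecting with U m
  -- for every m < u in D u (all of D u lies below u).  I is not assumed r.e., so a ∈ I is
  -- certified by some H a a c instead.
  CapIndex : ℕ → ℕ → Set
  CapIndex u i = ∃ λ a → (∃ λ c → H a a c) × Path (Step u) u a i

  Path-I : ∀ {u L a b} → I a → Path (Step u) L a b → I b
  Path-I {L = zero} Ia refl = Ia
  Path-I {L = suc L} Ia (c , path , inj₁ (_ , refl)) = Path-I Ia path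
  Path-I {L = suc L} Ia (c , path , inj₂ (_ , Hc)) = proj₂ (proj₂ (H⊆I³ c L _ Hc))

  step-sound : ∀ {u m a b x} → Step u m a b → I a → U b x →
    U a x × (D u m → [ x ]⟨ I , U ⟩ m)
  step-sound (inj₁ (bit≡0 , refl)) _ x∈Ub =
    x∈Ub , λ Dum → ⊥-elim (0≢1+n (trans (sym bit≡0) Dum))
  step-sound {m = m} {a} {b} {x} (inj₂ (_ , Hamb)) Ia x∈Ub =
    let _ , Im , _ = H⊆I³ a m b Hamb
        x∈Ua , x∈Um = from (H-∩ a m Ia Im x) (b , Hamb , x∈Ub)
    in x∈Ua , λ _ → Im , x∈Um

  Path-sound : ∀ {u L a b x} → I a → Path (Step u) L a b → U b x →
    U a x × (∀ k → k < L → D u k → [ x ]⟨ I , U ⟩ k)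
  Path-sound {L = zero} _ refl x∈Ub = x∈Ub , λ _ ()
  Path-sound {L = suc L} Ia (c , path , step) x∈Ub =
    let x∈Uc , at-L = step-sound step (Path-I Ia path) x∈Ub
        x∈Ua , below-L = Path-sound Ia path x∈Uc
    in x∈Ua , λ k k<1+L Duk →
         [ (λ k<L → below-L k k<L Duk) , (λ { refl → at-L Duk }) ]′ (m<1+n⇒m<n∨m≡n k<1+L)

  step-complete : ∀ {u m a x} → I a → U a x → (D u m → [ x ]⟨ I , U ⟩ m) →
    ∃ λ b → Step u m a b × U b x
  step-complete {u} {m} {a} {x} Ia x∈Ua D⇒x∈Um with bit≡0⊎D u m
  ... | inj₁ bit≡0 = a , inj₁ (bit≡0 , refl) , x∈Ua
  ... | inj₂ Dum =
    let Im , x∈Um = D⇒x∈Um Dum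
        b , Hamb , x∈Ub = to (H-∩ a m Ia Im x) (x∈Ua , x∈Um)
    in b , inj₂ (Dum , Hamb) , x∈Ub

  Path-complete : ∀ {u a x} L → I a → U a x → D u ⊆ [ x ]⟨ I , U ⟩ →
    ∃ λ b → Path (Step u) L a b × U b x
  Path-complete {a = a} zero Ia x∈Ua _ = a , refl , x∈Ua
  Path-complete (suc L) Ia x∈Ua D⊆[x] =
    let c , path , x∈Uc = Path-complete L Ia x∈Ua D⊆[x]
        b , step , x∈Ub = step-complete (Path-I Ia path) x∈Uc (D⊆[x] L)
    in b , (c , path , step) , x∈Ub

  capIndex-I : ∀ {u i} → CapIndex u i → I i
  capIndex-I (a , (c , Haac) , path) = Path-I (proj₁ (H⊆I³ a a c Haac)) path

  capIndex-sound : ∀ {u i x} → CapIndex u i → U i x → D u ⊆ [ x ]⟨ I , U ⟩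
  capIndex-sound (a , (c , Haac) , path) x∈Ui k Duk =
    proj₂ (Path-sound (proj₁ (H⊆I³ a a c Haac)) path x∈Ui) k (D⇒< Duk) Duk

  capIndex-complete : ∀ {u a x} → I a → U a x → D u ⊆ [ x ]⟨ I , U ⟩ →
    ∃ λ i → CapIndex u i × U i x
  capIndex-complete {u} {a} {x} Ia x∈Ua D⊆[x] =
    let c , Haac , _ = to (H-∩ a a Ia Ia x) (x∈Ua , x∈Ua)
        i , path , x∈Ui = Path-complete u Ia x∈Ua D⊆[x]
    in i , (a , (c , Haac) , path) , x∈Ui

  StepRel : ℕ → ℕ → ℕ → Vec ℕ 1 → Set
  StepRel m a b (u ∷ []) = Step u m a b

  re-CapIndex : RE₃ H → RE₂ CapIndex
  re-CapIndex reH = re-resp (λ { (u ∷ i ∷ []) → ⇔-refl })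
    (re-∃ (re-∧ (re-∃ (re-subst reH (var (# 1) ∷ var (# 1) ∷ var zero ∷ [])))
                (re-subst (re-Path reStepRel) (var (# 1) ∷ var zero ∷ var (# 2) ∷ var (# 1) ∷ []))))
    where
    bitE : Expr 4
    bitE = app₂ bit-primRec (var (# 3)) (var zero)
    reStepRel : RERel 4 (Uncurry₃ StepRel)
    reStepRel = re-resp (λ { (m ∷ a ∷ b ∷ u ∷ []) → ⇔-refl })
      (re-⊎ (re-∧ (re-≡ bitE (lit 0)) (re-≡ (var (# 1)) (var (# 2))))
            (re-∧ (re-≡ bitE (lit 1)) (re-subst reH (var (# 1) ∷ var zero ∷ var (# 2) ∷ []))))

  capSystem : (ℕ → Set) → (ℕ → ℕ → Set) → ℕ → ℕ → Set
  capSystem J W i j = J j × ∃ λ u → W j u × CapIndex u i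

  re-capSystem : ∀ {J W} → RE J → RE₂ W → RE₃ H → RE₂ (capSystem J W)
  re-capSystem reJ reW reH = re-resp (λ { (i ∷ j ∷ []) → ⇔-refl })
    (re-∧ (re-subst reJ (var (# 1) ∷ []))
          (re-∃ (re-∧ (re-subst reW (var (# 2) ∷ var zero ∷ []))
                      (re-subst (re-CapIndex reH) (var zero ∷ var (# 1) ∷ [])))))

  computable⇒approxSystem : ∀ {Y J V E f} → (∀ x → ∃ λ a → I a × U a x) → RE J → RE₃ H →
    IsComputable I U J V E f →
    Σ (ℕ → ℕ → Set) λ R → RE₂ R × IsApproxSystem {X} {Y} I U J V E f R
  computable⇒approxSystem {J = J} {V} {E} {f} covers reJ reH (F , (W , reW , F⇔ΦW) , computes) =
    capSystem J W , re-capSystem reJ reW reH , R⊆I×J , approximates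
    where
    R⊆I×J : ∀ i j → capSystem J W i j → I i × J j
    R⊆I×J i j (Jj , _ , _ , ci) = capIndex-I ci , Jj
    approximates : ∀ x (e : E x) j → J j → V j (f x e) ⇔ (∃ λ i → capSystem J W i j × U i x)
    approximates x e j Jj = mk⇔
      (λ fx∈Vj →
        let u , Wju , D⊆[x] = to (F⇔ΦW _ j) (to (computes x e j) (Jj , fx∈Vj))
            a , Ia , x∈Ua = covers x
            i , ci , x∈Ui = capIndex-complete Ia x∈Ua D⊆[x]
        in i , (Jj , u , Wju , ci) , x∈Ui)
      (λ (i , (_ , u , Wju , ci) , x∈Ui) →
        proj₂ (from (computes x e j) (from (F⇔ΦW _ j) (u , Wju , capIndex-sound ci x∈Ui))))

corollary2p11 : {X Y : Set} (TX : Topology X) (TY : Topology Y)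
    (I : ℕ → Set) (U : ℕ → X → Set) (J : ℕ → Set) (V : ℕ → Y → Set) →
    IsBase TX I U → IsBase TY J V →
    (E : X → Set) (f : (x : X) → E x → Y) →
    RE J →
    (Σ (ℕ → ℕ → ℕ → Set) λ H → RE₃ H ×
      (∀ a b c → H a b c → I a × I b × I c) ×
      (∀ a b → I a → I b → ∀ x → (U a x × U b x) ⇔ (∃ λ c → H a b c × U c x))) →
    IsComputable I U J V E f ⇔
      (Σ (ℕ → ℕ → Set) λ R → RE₂ R × IsApproxSystem I U J V E f R)
corollary2p11 TX TY I U J V baseX baseY E f reJ (H , reH , H⊆I³ , H-∩) = mk⇔
  (computable⇒approxSystem H⊆I³ H-∩ {V = V} {f = f} (IsBase-covers baseX) reJ reH)
  (λ (R , reR , isApprox) → approxSystem⇒computable {V = V} {f = f} reR isApprox)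
  where open BasicIntersections
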